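{- Every hypertree with an even number of edges has a vertex of even degree.
   Context: A hypergraph has a finite vertex set and edges that are subsets of size at least $2$; the degree of a vertex is the number of edges containing it. A hypertree is a hypergraph whose incidence graph (bipartite graph on vertices and edges, with $v$ adjacent to $e$ iff $v\in e$) is a tree. -}

module Defs where

open import Data.Nat using (ℕ; suc; _≤_)
open import Data.Nat.Divisibility using (_∣_)
open import Data.Fin using (Fin; zero; suc; inject₁; fromℕ)
open import Data.Fin.Subset using (Subset; _∈_; ∣_∣)
open import Data.Vec using (tabulate; lookup)
open import Data.Sum using (_⊎_; inj₁; inj₂)
open import Data.Product using (Σ; ∃; _×_)
open import Data.Empty using (⊥)
open import Function.Definitions using (Injective)
open import Relation.Binary.PropositionalEquality using (_≡_)
open import Relation.Binary.Construct.Closure.ReflexiveTransitive using (Star)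
open import Relation.Nullary using (¬_)

record Hypergraph (n m : ℕ) : Set where
  field
    edge    : Fin m → Subset n
    size≥2  : ∀ e → 2 ≤ ∣ edge e ∣

open Hypergraph public

degree : ∀ {n m} → Hypergraph n m → Fin n → ℕ
degree H v = ∣ tabulate (λ e → lookup (edge H e) v) ∣

Even : ℕ → Set
Even k = 2 ∣ k

-- Incidence graph: bipartite simple graph on vertices ⊎ edges.
IVertex : ℕ → ℕ → Set
IVertex n m = Fin n ⊎ Fin m

IAdj : ∀ {n m} → Hypergraph n m → IVertex n m → IVertex n m → Set
IAdj H (inj₁ v) (inj₂ e) = v ∈ edge H e
IAdj H (inj₂ e) (inj₁ v) = v ∈ edge H e
IAdj H (inj₁ _) (inj₁ _) = ⊥
IAdj H (inj₂ _) (inj₂ _) = ⊥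

Connected : ∀ {n m} → Hypergraph n m → Set
Connected {n} {m} H =
  IVertex n m × ((x y : IVertex n m) → Star (IAdj H) x y)

Cycle : ∀ {n m} → Hypergraph n m → Set
Cycle {n} {m} H =
  Σ ℕ λ k → Σ (Fin (suc (suc (suc k))) → IVertex n m) λ c →
    Injective _≡_ _≡_ c
    × ((i : Fin (suc (suc k))) → IAdj H (c (inject₁ i)) (c (suc i)))
    × IAdj H (c (fromℕ (suc (suc k)))) (c zero)

Acyclic : ∀ {n m} → Hypergraph n m → Set
Acyclic H = ¬ Cycle H

IsHypertree : ∀ {n m} → Hypergraph n m → Set
IsHypertree H = Connected H × Acyclic H

-- Root the incidence tree at a vertex and send every other node to its parent, a neighbour
-- one step closer to the root. A node cannot have two neighbours closer to the root: following
-- parents from both until they first meet would close a cycle. So each incidence v ∈ e says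
-- either that v is the parent of e or that e is the parent of v, but not both, and the degrees
-- add up to m (every edge has a parent vertex) plus n − 1 (every non-root vertex has a parent
-- edge). If all n degrees were odd, their sum would have the parity of n, making m odd.
module Submission where

open import Data.Bool.Base using (Bool; true; false; not)
open import Data.Bool.Properties using (not-¬)
open import Data.Empty using (⊥; ⊥-elim)
open import Data.Fin.Base using (Fin; zero; suc; toℕ; inject₁; fromℕ)
open import Data.Fin.Properties using (toℕ-injective; toℕ-inject₁; toℕ-fromℕ; toℕ<n; toℕ≤pred[n])
import Data.Fin.Properties as Finₚ
open import Data.Fin.Subset using (Subset; ∣_∣)
open import Data.Fin.Subset.Properties using (_∈?_)
open import Data.Nat.Base
open import Data.Nat.Divisibility using (divides; _∣?_; _∣0; ∣-refl; ∣m∣n⇒∣m+n; ∣m+n∣m⇒∣n)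
open import Data.Nat.GeneralisedArithmetic using (fold)
open import Data.Nat.Induction using (<-rec)
open import Data.Nat.Properties hiding (_≟_)
import Data.Nat.Properties as ℕ
open import Data.Product using (Σ; ∃; _×_; _,_; proj₁; proj₂)
open import Data.Sum.Base using (_⊎_; inj₁; inj₂)
open import Data.Sum.Properties using (≡-dec)
open import Data.Vec.Base using ([]; _∷_; tabulate; lookup)
open import Function.Base using (_∘_)
open import Function.Definitions using (Injective)
open import Level using (0ℓ)
open import Relation.Binary.Core using (Rel)
open import Relation.Binary.Definitions using (DecidableEquality; Decidable; Symmetric; tri<; tri≈; tri>)
open import Relation.Binary.Construct.Closure.ReflexiveTransitive using (Star; ε; _◅_)
open import Relation.Binary.PropositionalEquality
open import Relation.Nullary using (Dec; yes; no; ¬_; does)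
open import Relation.Nullary.Decidable using (_×-dec_; _⊎-dec_; dec-true; dec-false; map′)
open import Relation.Unary as U using (Pred)

open import Algebra.Properties.CommutativeMonoid.Sum +-0-commutativeMonoid using (sum-syntax; sum-cong-≗; sum-replicate-zero; ∑-distrib-+; ∑-comm)

open import Defs

open ≡-Reasoning

IsLeast : (ℕ → Set) → ℕ → Set
IsLeast P m = P m × (∀ {j} → j < m → ¬ P j)

least : {P : ℕ → Set} → U.Decidable P → ∀ {k} → P k → ∃ (IsLeast P)
least {P} P? {k} = <-rec (λ k → P k → ∃ (IsLeast P)) search k
  where
  search : ∀ k → (∀ {j} → j < k → P j → ∃ (IsLeast P)) → P k → ∃ (IsLeast P)
  search k smaller pk with anyUpTo? P? k
  ... | yes (j , j<k , pj) = smaller j<k pj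
  ... | no none            = k , pk , λ j<k pj → none (_ , j<k , pj)

least-≤ : ∀ {P : ℕ → Set} {m k} → IsLeast P m → P k → m ≤ k
least-≤ (_ , below) pk = ≮⇒≥ (λ k<m → below k<m pk)

𝟙 : Bool → ℕ
𝟙 true  = 1
𝟙 false = 0

∣tabulate∣≡∑𝟙 : ∀ {k} (p : Fin k → Bool) → ∣ tabulate p ∣ ≡ ∑[ i < k ] 𝟙 (p i)
∣tabulate∣≡∑𝟙 {zero}  p = refl
∣tabulate∣≡∑𝟙 {suc k} p with p zero
... | true  = cong suc (∣tabulate∣≡∑𝟙 (p ∘ suc))
... | false = ∣tabulate∣≡∑𝟙 (p ∘ suc)

∑-one : ∀ k → ∑[ i < k ] 1 ≡ k
∑-one zero    = refl
∑-one (suc k) = cong suc (∑-one k)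

∑-𝟙-≟ : ∀ {k} (u : Fin k) → ∑[ i < k ] 𝟙 (does (u Finₚ.≟ i)) ≡ 1
∑-𝟙-≟ {suc k} zero    = cong suc (sum-replicate-zero k)
∑-𝟙-≟ {suc k} (suc u) = ∑-𝟙-≟ u

even-suc-of-odd : ∀ n → ¬ Even n → Even (suc n)
even-suc-of-odd zero          odd = ⊥-elim (odd (2 ∣0))
even-suc-of-odd (suc zero)    _   = ∣-refl
even-suc-of-odd (suc (suc n)) odd =
  ∣m∣n⇒∣m+n ∣-refl (even-suc-of-odd n (odd ∘ ∣m∣n⇒∣m+n ∣-refl))

n+1+n-not-even : ∀ n → ¬ Even (n + suc n)
n+1+n-not-even n (divides q eq) = even≢odd q n (begin
  2 * q          ≡⟨ *-comm 2 q ⟩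
  q * 2          ≡⟨ eq ⟨
  n + suc n      ≡⟨ +-suc n n ⟩
  suc (n + n)    ≡⟨ cong (λ t → suc (n + t)) (+-identityʳ n) ⟨
  suc (2 * n)    ∎)

∑-even : ∀ {k} (f : Fin k → ℕ) → (∀ i → Even (f i)) → Even (∑[ i < k ] f i)
∑-even {zero}  f even = 2 ∣0
∑-even {suc k} f even = ∣m∣n⇒∣m+n (even zero) (∑-even (f ∘ suc) (even ∘ suc))

∑-suc : ∀ {k} (f : Fin k → ℕ) → ∑[ i < k ] suc (f i) ≡ ∑[ i < k ] f i + k
∑-suc {zero}  f = refl
∑-suc {suc k} f = begin
  suc (f zero + ∑[ i < k ] suc (f (suc i))) ≡⟨ cong (λ t → suc (f zero + t)) (∑-suc (f ∘ suc)) ⟩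
  suc (f zero + (∑[ i < k ] f (suc i) + k)) ≡⟨ cong suc (+-assoc (f zero) _ k) ⟨
  suc (f zero + ∑[ i < k ] f (suc i) + k)   ≡⟨ +-suc _ k ⟨
  f zero + ∑[ i < k ] f (suc i) + suc k     ∎

∑-odd : ∀ {k} (f : Fin k → ℕ) → (∀ i → ¬ Even (f i)) → Even (∑[ i < k ] f i + k)
∑-odd f odd = subst Even (∑-suc f) (∑-even (λ i → suc (f i)) (λ i → even-suc-of-odd (f i) (odd i)))

-- Cycle H of Defs is GraphCycle (IAdj H) by definition.
GraphCycle : {V : Set} → Rel V 0ℓ → Set
GraphCycle {V} Adj =
  Σ ℕ λ k → Σ (Fin (suc (suc (suc k))) → V) λ c →
    Injective _≡_ _≡_ c
    × ((i : Fin (suc (suc k))) → Adj (c (inject₁ i)) (c (suc i)))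
    × Adj (c (fromℕ (suc (suc k)))) (c zero)

sequence-cycle : {V : Set} {Adj : Rel V 0ℓ} (c : ℕ → V) (ℓ : ℕ) →
  (∀ {i j} → i ≤ suc (suc ℓ) → j ≤ suc (suc ℓ) → c i ≡ c j → i ≡ j) →
  (∀ {i} → i < suc (suc ℓ) → Adj (c i) (c (suc i))) →
  Adj (c (suc (suc ℓ))) (c 0) →
  GraphCycle Adj
sequence-cycle {Adj = Adj} c ℓ injective adjacent closing =
  ℓ , c ∘ toℕ , injective′ , adjacent′ , closing′
  where
  injective′ : Injective _≡_ _≡_ (c ∘ toℕ)
  injective′ {i} {j} eq = toℕ-injective (injective (toℕ≤pred[n] i) (toℕ≤pred[n] j) eq)

  adjacent′ : ∀ i → Adj (c (toℕ (inject₁ i))) (c (suc (toℕ i)))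
  adjacent′ i rewrite toℕ-inject₁ i = adjacent (toℕ<n i)

  closing′ : Adj (c (toℕ (fromℕ (suc (suc ℓ))))) (c 0)
  closing′ rewrite toℕ-fromℕ (suc (suc ℓ)) = closing

module RootedTree
  {V : Set} (_≟_ : DecidableEquality V)
  (any? : ∀ {P : Pred V 0ℓ} → U.Decidable P → Dec (∃ P))
  {Adj : Rel V 0ℓ} (adj? : Decidable Adj) (adj-sym : Symmetric Adj)
  (colour : V → Bool) (colour-flips : ∀ {x y} → Adj x y → colour y ≡ not (colour x))
  (root : V) (reaches-root : ∀ x → Star Adj x root)
  where

  Reaches : ℕ → V → Set
  Reaches zero    x = x ≡ root
  Reaches (suc k) x = ∃ λ y → Adj x y × Reaches k y

  reaches? : ∀ k → U.Decidable (Reaches k)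
  reaches? zero    x = x ≟ root
  reaches? (suc k) x = any? (λ y → adj? x y ×-dec reaches? k y)

  star⇒reaches : ∀ {x} → Star Adj x root → ∃ λ k → Reaches k x
  star⇒reaches ε            = 0 , refl
  star⇒reaches (x~y ◅ walk) = let k , r = star⇒reaches walk in suc k , _ , x~y , r

  colour-reaches : ∀ {k x} → Reaches k x → colour x ≡ fold (colour root) not k
  colour-reaches {zero}  refl            = refl
  colour-reaches {suc k} (y , x~y , r) = trans (colour-flips (adj-sym x~y)) (cong not (colour-reaches r))

  opaque
    depth-spec : ∀ x → ∃ (IsLeast (λ k → Reaches k x))
    depth-spec x = least (λ k → reaches? k x) (proj₂ (star⇒reaches (reaches-root x)))

  depth : V → ℕ
  depth x = proj₁ (depth-spec x)

  depth-reaches : ∀ x → Reaches (depth x) x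
  depth-reaches x = proj₁ (proj₂ (depth-spec x))

  depth-≤ : ∀ {k x} → Reaches k x → depth x ≤ k
  depth-≤ {x = x} = least-≤ (proj₂ (depth-spec x))

  depth≡0⇒root : ∀ {x} → depth x ≡ 0 → x ≡ root
  depth≡0⇒root {x} d≡0 = subst (λ k → Reaches k x) d≡0 (depth-reaches x)

  depth-root : depth root ≡ 0
  depth-root = n≤0⇒n≡0 (depth-≤ refl)

  adjacent-depth-≤ : ∀ {x y} → Adj x y → depth x ≤ suc (depth y)
  adjacent-depth-≤ {y = y} x~y = depth-≤ (y , x~y , depth-reaches y)

  -- Walks to the root from adjacent nodes differ in parity, as the colouring is proper.
  adjacent-depth-≢ : ∀ {x y} → Adj x y → depth x ≢ depth y
  adjacent-depth-≢ {x} {y} x~y eq = not-¬ same-colour (colour-flips x~y)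
    where
    same-colour : colour y ≡ colour x
    same-colour = begin
      colour y                            ≡⟨ colour-reaches (depth-reaches y) ⟩
      fold (colour root) not (depth y)    ≡⟨ cong (fold (colour root) not) eq ⟨
      fold (colour root) not (depth x)    ≡⟨ colour-reaches (depth-reaches x) ⟨
      colour x                            ∎

  adjacent-depths : ∀ {x y} → Adj x y → suc (depth y) ≡ depth x ⊎ suc (depth x) ≡ depth y
  adjacent-depths {x} {y} x~y with <-cmp (depth x) (depth y)
  ... | tri< x<y _ _ = inj₂ (≤-antisym x<y (adjacent-depth-≤ (adj-sym x~y)))
  ... | tri≈ _ x≡y _ = ⊥-elim (adjacent-depth-≢ x~y x≡y)
  ... | tri> _ _ y<x = inj₁ (≤-antisym y<x (adjacent-depth-≤ x~y))

  DownEdge : Rel V 0ℓ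
  DownEdge x y = Adj x y × suc (depth y) ≡ depth x

  down-edge? : Decidable DownEdge
  down-edge? x y = adj? x y ×-dec (suc (depth y) ℕ.≟ depth x)

  down-edge-exists : ∀ {x} → depth x ≢ 0 → ∃ (DownEdge x)
  down-edge-exists {x} d≢0 = step (subst (λ k → Reaches k x) d≡1+k (depth-reaches x))
    where
    d≡1+k : depth x ≡ suc (pred (depth x))
    d≡1+k = sym (suc-pred (depth x) {{≢-nonZero d≢0}})

    step : Reaches (suc (pred (depth x))) x → ∃ (DownEdge x)
    step (y , x~y , r) =
      y , x~y , ≤-antisym (≤-trans (s≤s (depth-≤ r)) (≤-reflexive (sym d≡1+k))) (adjacent-depth-≤ x~y)

  parent : V → V
  parent x with any? (down-edge? x)
  ... | yes (y , _) = y
  ... | no _        = x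

  parent-down : ∀ {x} → depth x ≢ 0 → DownEdge x (parent x)
  parent-down {x} d≢0 with any? (down-edge? x)
  ... | yes (_ , x↓y) = x↓y
  ... | no none       = ⊥-elim (none (down-edge-exists d≢0))

  parent-root : parent root ≡ root
  parent-root with any? (down-edge? root)
  ... | yes (_ , _ , eq) = ⊥-elim (0≢1+n (trans (sym depth-root) (sym eq)))
  ... | no _             = refl

  parent-cases : ∀ x → (x ≡ root × parent x ≡ x) ⊎ DownEdge x (parent x)
  parent-cases x with x ≟ root
  ... | yes refl = inj₁ (refl , parent-root)
  ... | no x≢root = inj₂ (parent-down (x≢root ∘ depth≡0⇒root))

  parent-adjacent : ∀ {x} → x ≢ root → Adj x (parent x)
  parent-adjacent {x} x≢root with parent-cases x
  ... | inj₁ (x≡root , _) = ⊥-elim (x≢root x≡root)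
  ... | inj₂ (x~p , _)    = x~p

  parent-antisym : ∀ {x y} → parent x ≡ y → parent y ≡ x → x ≡ y
  parent-antisym {x} {y} px≡y py≡x with parent-cases x | parent-cases y
  ... | inj₁ (_ , px≡x) | _               = trans (sym px≡x) px≡y
  ... | inj₂ _          | inj₁ (_ , py≡y) = trans (sym py≡x) py≡y
  ... | inj₂ (_ , x↓)   | inj₂ (_ , y↓)   = ⊥-elim (<-asym (≤-reflexive y<x) (≤-reflexive x<y))
    where
    y<x : suc (depth y) ≡ depth x
    y<x = subst (λ z → suc (depth z) ≡ depth x) px≡y x↓
    x<y : suc (depth x) ≡ depth y
    x<y = subst (λ z → suc (depth z) ≡ depth y) py≡x y↓

  ancestor : V → ℕ → V
  ancestor x i = fold x parent i

  depth-ancestor : ∀ {x i} → i ≤ depth x → depth (ancestor x i) + i ≡ depth x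
  ancestor-nonroot : ∀ {x i} → i < depth x → depth (ancestor x i) ≢ 0

  depth-ancestor {i = zero}    _   = +-identityʳ _
  depth-ancestor {x} {suc i} i<d = begin
    depth (parent y) + suc i    ≡⟨ +-suc _ i ⟩
    suc (depth (parent y)) + i  ≡⟨ cong (_+ i) (proj₂ (parent-down (ancestor-nonroot i<d))) ⟩
    depth y + i                 ≡⟨ depth-ancestor (<⇒≤ i<d) ⟩
    depth x                     ∎
    where y = ancestor x i

  ancestor-nonroot {x} {i} i<d y≡0 =
    <⇒≢ i<d (trans (sym (cong (_+ i) y≡0)) (depth-ancestor {x} {i} (<⇒≤ i<d)))

  ancestor-adjacent : ∀ {x i} → i < depth x → Adj (ancestor x i) (ancestor x (suc i))
  ancestor-adjacent i<d = proj₁ (parent-down (ancestor-nonroot i<d))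

  ancestor-depth : ∀ x → ancestor x (depth x) ≡ root
  ancestor-depth x = depth≡0⇒root (+-cancelʳ-≡ (depth x) _ 0 (depth-ancestor ≤-refl))

  down-edges-same-depth : ∀ {x a b} → DownEdge x a → DownEdge x b → depth b ≡ depth a
  down-edges-same-depth (_ , a↓) (_ , b↓) = suc-injective (trans b↓ (sym a↓))

  ancestors-meet : ∀ {a b} → depth b ≡ depth a → ancestor a (depth a) ≡ ancestor b (depth a)
  ancestors-meet {a} {b} db≡da =
    trans (ancestor-depth a) (sym (subst (λ d → ancestor b d ≡ root) db≡da (ancestor-depth b)))

  -- Two distinct down edges x → a, x → b close a cycle: x, a, …, A K = B K, …, b, where
  -- A, B are the ancestor chains of a and b and K = suc k is the index where they first meet.
  module DescentCycle {x a b} (x↓a : DownEdge x a) (x↓b : DownEdge x b) (k : ℕ)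
    (first-meet : IsLeast (λ i → ancestor a i ≡ ancestor b i) (suc k)) where

    K h : ℕ
    K = suc k
    h = depth a

    A B : ℕ → V
    A = ancestor a
    B = ancestor b

    db≡h : depth b ≡ h
    db≡h = down-edges-same-depth x↓a x↓b

    K≤h : K ≤ h
    K≤h = least-≤ first-meet (ancestors-meet db≡h)

    depth-A : ∀ {i} → i ≤ K → depth (A i) + i ≡ h
    depth-A i≤K = depth-ancestor (≤-trans i≤K K≤h)

    depth-B : ∀ {j} → j ≤ K → depth (B j) + j ≡ h
    depth-B j≤K = trans (depth-ancestor (≤-trans j≤K (≤-trans K≤h (≤-reflexive (sym db≡h))))) db≡h

    c : ℕ → V
    c zero    = x
    c (suc i) with i <? K
    ... | yes _ = A i
    ... | no _  = B (K ∸ (i ∸ K))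

    c-A : ∀ {i} → i < K → c (suc i) ≡ A i
    c-A {i} i<K with i <? K
    ... | yes _   = refl
    ... | no i≮K = ⊥-elim (i≮K i<K)

    c-B : ∀ {t} → t ≤ K → c (suc (K + t)) ≡ B (K ∸ t)
    c-B {t} _ with K + t <? K
    ... | yes K+t<K = ⊥-elim (m+n≮m K t K+t<K)
    ... | no _      = cong (λ s → B (K ∸ s)) (m+n∸m≡n K t)

    c-A′ : ∀ {i} → i ≤ K → c (suc i) ≡ A i
    c-A′ i≤K with m≤n⇒m<n∨m≡n i≤K
    ... | inj₁ i<K  = c-A i<K
    ... | inj₂ refl = begin
      c (suc K)        ≡⟨ cong (c ∘ suc) (+-identityʳ K) ⟨
      c (suc (K + 0))  ≡⟨ c-B z≤n ⟩
      B K              ≡⟨ proj₁ first-meet ⟨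
      A K              ∎

    data Position : ℕ → Set where
      apex : Position 0
      onA  : ∀ {i} → i < K → Position (suc i)
      onB  : ∀ {t} → t ≤ K → Position (suc (K + t))

    position : ∀ {i} → i ≤ suc (K + K) → Position i
    position {zero}  _ = apex
    position {suc i} i≤ with i <? K
    ... | yes i<K = onA i<K
    ... | no i≮K  = subst (Position ∘ suc) (m+[n∸m]≡n (≮⇒≥ i≮K)) (onB t≤K)
      where
      t≤K : i ∸ K ≤ K
      t≤K = ≤-trans (∸-monoˡ-≤ K (s≤s⁻¹ i≤)) (≤-reflexive (m+n∸m≡n K K))

    depth-onA : ∀ {i} → i < K → depth (c (suc i)) + i ≡ h
    depth-onA {i} i<K = trans (cong (λ u → depth u + i) (c-A i<K)) (depth-A (<⇒≤ i<K))

    depth-onB : ∀ {t} → t ≤ K → depth (c (suc (K + t))) + (K ∸ t) ≡ h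
    depth-onB {t} t≤K = trans (cong (λ u → depth u + (K ∸ t)) (c-B t≤K)) (depth-B (m∸n≤m K t))

    offsets-equal : ∀ {u w i j} → u ≡ w → depth u + i ≡ h → depth w + j ≡ h → i ≡ j
    offsets-equal {u} refl eq₁ eq₂ = +-cancelˡ-≡ (depth u) _ _ (trans eq₁ (sym eq₂))

    below-apex : ∀ {u j} → x ≡ u → depth u + j ≡ h → ⊥
    below-apex {j = j} refl eq =
      <-irrefl refl (≤-trans (m≤m+n (suc h) j) (≤-reflexive (trans (cong (_+ j) (proj₂ x↓a)) eq)))

    A-B-apart : ∀ {i t} → i < K → t ≤ K → c (suc i) ≢ c (suc (K + t))
    A-B-apart {i} {t} i<K t≤K eq = proj₂ first-meet i<K (begin
      A i              ≡⟨ c-A i<K ⟨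
      c (suc i)        ≡⟨ eq ⟩
      c (suc (K + t))  ≡⟨ c-B t≤K ⟩
      B (K ∸ t)        ≡⟨ cong B (offsets-equal eq (depth-onA i<K) (depth-onB t≤K)) ⟨
      B i              ∎)

    same-position : ∀ {i j} → Position i → Position j → c i ≡ c j → i ≡ j
    same-position apex          apex          _  = refl
    same-position apex          (onA j<K)     eq = ⊥-elim (below-apex eq (depth-onA j<K))
    same-position apex          (onB u≤K)     eq = ⊥-elim (below-apex eq (depth-onB u≤K))
    same-position (onA i<K)     apex          eq = ⊥-elim (below-apex (sym eq) (depth-onA i<K))
    same-position (onB t≤K)     apex          eq = ⊥-elim (below-apex (sym eq) (depth-onB t≤K))
    same-position (onA i<K)     (onA j<K)     eq = cong suc (offsets-equal eq (depth-onA i<K) (depth-onA j<K))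
    same-position (onA i<K)     (onB u≤K)     eq = ⊥-elim (A-B-apart i<K u≤K eq)
    same-position (onB t≤K)     (onA j<K)     eq = ⊥-elim (A-B-apart j<K t≤K (sym eq))
    same-position (onB t≤K)     (onB u≤K)     eq = cong (λ t → suc (K + t))
      (∸-cancelˡ-≡ t≤K u≤K (offsets-equal eq (depth-onB t≤K) (depth-onB u≤K)))

    c-injective : ∀ {i j} → i ≤ suc (K + K) → j ≤ suc (K + K) → c i ≡ c j → i ≡ j
    c-injective i≤ j≤ = same-position (position i≤) (position j≤)

    step : ∀ {i} → Position i → i < suc (K + K) → Adj (c i) (c (suc i))
    step apex _ = subst (Adj x) (sym (c-A z<s)) (proj₁ x↓a)
    step (onA {i} i<K) _ =
      subst₂ Adj (sym (c-A i<K)) (sym (c-A′ i<K)) (ancestor-adjacent (≤-trans i<K K≤h))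
    step (onB {t} t≤K) bound = subst₂ Adj (sym here) (sym next) (adj-sym (ancestor-adjacent s<db))
      where
      t<K : t < K
      t<K = +-cancelˡ-< K t K (s≤s⁻¹ bound)
      s = K ∸ suc t
      here : c (suc (K + t)) ≡ B (suc s)
      here = trans (c-B t≤K) (cong B (+-∸-assoc 1 (s≤s⁻¹ t<K)))
      next : c (suc (suc (K + t))) ≡ B s
      next = trans (cong (c ∘ suc) (sym (+-suc K t))) (c-B t<K)
      s<db : s < depth b
      s<db = ≤-trans (s≤s (m∸n≤m k t)) (≤-trans K≤h (≤-reflexive (sym db≡h)))

    c-adjacent : ∀ {i} → i < suc (K + K) → Adj (c i) (c (suc i))
    c-adjacent i< = step (position (<⇒≤ i<)) i<

    c-closing : Adj (c (suc (K + K))) x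
    c-closing = subst (λ u → Adj u x) (sym (trans (c-B ≤-refl) (cong B (n∸n≡0 K)))) (adj-sym (proj₁ x↓b))

    cycle : GraphCycle Adj
    cycle = sequence-cycle {Adj = Adj} c (k + K) c-injective c-adjacent c-closing

  down-edge-unique : ¬ GraphCycle Adj → ∀ {x y} → DownEdge x y → y ≡ parent x
  down-edge-unique acyclic {x} {y} x↓y with y ≟ parent x
  ... | yes y≡p = y≡p
  ... | no y≢p  = ⊥-elim (acyclic (cycle-from (least meet? {depth p} (ancestors-meet db≡dp))))
    where
    p = parent x
    x↓p : DownEdge x p
    x↓p = parent-down (λ d≡0 → 0≢1+n (trans (sym d≡0) (sym (proj₂ x↓y))))
    db≡dp : depth y ≡ depth p
    db≡dp = down-edges-same-depth x↓p x↓y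
    meet? : U.Decidable (λ i → ancestor p i ≡ ancestor y i)
    meet? i = ancestor p i ≟ ancestor y i
    cycle-from : ∃ (IsLeast (λ i → ancestor p i ≡ ancestor y i)) → GraphCycle Adj
    cycle-from (zero  , p≡y , _) = ⊥-elim (y≢p (sym p≡y))
    cycle-from (suc k , first-meet) = DescentCycle.cycle x↓p x↓y k first-meet

  adjacent⇒parent : ¬ GraphCycle Adj → ∀ {x y} → Adj x y → parent x ≡ y ⊎ parent y ≡ x
  adjacent⇒parent acyclic x~y with adjacent-depths x~y
  ... | inj₁ y↓ = inj₁ (sym (down-edge-unique acyclic (x~y , y↓)))
  ... | inj₂ x↓ = inj₂ (sym (down-edge-unique acyclic (adj-sym x~y , x↓)))

  parent⇒adjacent : ∀ {x y} → x ≢ y → parent x ≡ y → Adj x y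
  parent⇒adjacent {x} x≢y px≡y = subst (Adj x) px≡y (parent-adjacent x≢root)
    where
    x≢root : x ≢ root
    x≢root refl = x≢y (trans (sym parent-root) px≡y)

  𝟙-adjacent : ¬ GraphCycle Adj → ∀ {x y} → x ≢ y →
    𝟙 (does (adj? x y)) ≡ 𝟙 (does (parent y ≟ x)) + 𝟙 (does (parent x ≟ y))
  𝟙-adjacent acyclic {x} {y} x≢y with adj? x y
  ... | no ¬x~y = sym (cong₂ (λ b c → 𝟙 b + 𝟙 c)
    (dec-false (parent y ≟ x) (¬x~y ∘ adj-sym ∘ parent⇒adjacent (x≢y ∘ sym)))
    (dec-false (parent x ≟ y) (¬x~y ∘ parent⇒adjacent x≢y)))
  ... | yes x~y with adjacent⇒parent acyclic x~y
  ...   | inj₁ px≡y = sym (cong₂ (λ b c → 𝟙 b + 𝟙 c)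
    (dec-false (parent y ≟ x) (x≢y ∘ parent-antisym px≡y))
    (dec-true (parent x ≟ y) px≡y))
  ...   | inj₂ py≡x = sym (cong₂ (λ b c → 𝟙 b + 𝟙 c)
    (dec-true (parent y ≟ x) py≡x)
    (dec-false (parent x ≟ y) (x≢y ∘ λ px≡y → parent-antisym px≡y py≡x)))

does-∈? : ∀ {n} (v : Fin n) (p : Subset n) → does (v ∈? p) ≡ lookup p v
does-∈? zero    (true  ∷ p) = refl
does-∈? zero    (false ∷ p) = refl
does-∈? (suc v) (_ ∷ p)     = does-∈? v p

no-edges : ∀ {m} (H : Hypergraph 0 m) → ¬ Fin m
no-edges H e with edge H e | size≥2 H e
... | [] | ()

module IncidenceTree {n m} (H : Hypergraph (suc n) m) (tree : IsHypertree H) where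

  _≟_ : DecidableEquality (IVertex (suc n) m)
  _≟_ = ≡-dec Finₚ._≟_ Finₚ._≟_

  any? : ∀ {P : Pred (IVertex (suc n) m) 0ℓ} → U.Decidable P → Dec (∃ P)
  any? P? = map′
    (λ { (inj₁ (v , pv)) → inj₁ v , pv ; (inj₂ (e , pe)) → inj₂ e , pe })
    (λ { (inj₁ v , pv) → inj₁ (v , pv) ; (inj₂ e , pe) → inj₂ (e , pe) })
    (Finₚ.any? (P? ∘ inj₁) ⊎-dec Finₚ.any? (P? ∘ inj₂))

  incident? : Decidable (IAdj H)
  incident? (inj₁ v) (inj₂ e) = v ∈? edge H e
  incident? (inj₂ e) (inj₁ v) = v ∈? edge H e
  incident? (inj₁ _) (inj₁ _) = no λ ()
  incident? (inj₂ _) (inj₂ _) = no λ ()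

  incident-sym : Symmetric (IAdj H)
  incident-sym {inj₁ _} {inj₂ _} v∈e = v∈e
  incident-sym {inj₂ _} {inj₁ _} v∈e = v∈e

  is-vertex : IVertex (suc n) m → Bool
  is-vertex (inj₁ _) = true
  is-vertex (inj₂ _) = false

  is-vertex-flips : ∀ {x y} → IAdj H x y → is-vertex y ≡ not (is-vertex x)
  is-vertex-flips {inj₁ _} {inj₂ _} _ = refl
  is-vertex-flips {inj₂ _} {inj₁ _} _ = refl

  open RootedTree _≟_ any? incident? incident-sym is-vertex is-vertex-flips
    (inj₁ zero) (λ x → proj₂ (proj₁ tree) x (inj₁ zero))

  degree-via-parents : ∀ v → degree H v ≡
    ∑[ e < m ] (𝟙 (does (parent (inj₂ e) ≟ inj₁ v)) + 𝟙 (does (parent (inj₁ v) ≟ inj₂ e)))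
  degree-via-parents v = begin
    degree H v                                         ≡⟨ ∣tabulate∣≡∑𝟙 (λ e → lookup (edge H e) v) ⟩
    ∑[ e < m ] 𝟙 (lookup (edge H e) v)                 ≡⟨ sum-cong-≗ (cong 𝟙 ∘ sym ∘ does-∈? v ∘ edge H) ⟩
    ∑[ e < m ] 𝟙 (does (incident? (inj₁ v) (inj₂ e)))  ≡⟨ sum-cong-≗ (λ e → 𝟙-adjacent (proj₂ tree) {inj₁ v} {inj₂ e} (λ ())) ⟩
    _                                                  ∎

  edges-have-parent-vertex : ∑[ e < m ] ∑[ v < suc n ] 𝟙 (does (parent (inj₂ e) ≟ inj₁ v)) ≡ m
  edges-have-parent-vertex = trans (sum-cong-≗ one-parent) (∑-one m)
    where
    one-parent : ∀ e → ∑[ v < suc n ] 𝟙 (does (parent (inj₂ e) ≟ inj₁ v)) ≡ 1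
    one-parent e with parent (inj₂ e) | parent-adjacent {inj₂ e} (λ ())
    ... | inj₁ w | _ = ∑-𝟙-≟ w

  nonroot-vertices-have-parent-edge : ∑[ v < suc n ] ∑[ e < m ] 𝟙 (does (parent (inj₁ v) ≟ inj₂ e)) ≡ n
  nonroot-vertices-have-parent-edge = cong₂ _+_ root-has-none (trans (sum-cong-≗ one-parent) (∑-one n))
    where
    root-has-none : ∑[ e < m ] 𝟙 (does (parent (inj₁ zero) ≟ inj₂ e)) ≡ 0
    root-has-none rewrite parent-root = sum-replicate-zero m
    one-parent : ∀ w → ∑[ e < m ] 𝟙 (does (parent (inj₁ (suc w)) ≟ inj₂ e)) ≡ 1
    one-parent w with parent (inj₁ (suc w)) | parent-adjacent {inj₁ (suc w)} (λ ())
    ... | inj₂ f | _ = ∑-𝟙-≟ f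

  ∑-degree : ∑[ v < suc n ] degree H v ≡ m + n
  ∑-degree = begin
    ∑[ v < suc n ] degree H v
      ≡⟨ sum-cong-≗ (λ v → trans (degree-via-parents v) (∑-distrib-+ (up v) (down v))) ⟩
    ∑[ v < suc n ] (∑[ e < m ] up v e + ∑[ e < m ] down v e)
      ≡⟨ ∑-distrib-+ (λ v → ∑[ e < m ] up v e) (λ v → ∑[ e < m ] down v e) ⟩
    ∑[ v < suc n ] ∑[ e < m ] up v e + ∑[ v < suc n ] ∑[ e < m ] down v e
      ≡⟨ cong (_+ ∑[ v < suc n ] ∑[ e < m ] down v e) (∑-comm up) ⟩
    ∑[ e < m ] ∑[ v < suc n ] up v e + ∑[ v < suc n ] ∑[ e < m ] down v e
      ≡⟨ cong₂ _+_ edges-have-parent-vertex nonroot-vertices-have-parent-edge ⟩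
    m + n ∎
    where
    up down : Fin (suc n) → Fin m → ℕ
    up v e = 𝟙 (does (parent (inj₂ e) ≟ inj₁ v))
    down v e = 𝟙 (does (parent (inj₁ v) ≟ inj₂ e))

lemma2 : (n m : ℕ) (H : Hypergraph n m) → IsHypertree H → Even m →
    ∃ λ (v : Fin n) → Even (degree H v)
lemma2 zero    m H ((inj₁ () , _) , _) _
lemma2 zero    m H ((inj₂ e  , _) , _) _ = ⊥-elim (no-edges H e)
lemma2 (suc n) m H tree even-m with Finₚ.any? (λ v → 2 ∣? degree H v)
... | yes even-vertex = even-vertex
... | no no-even-vertex = ⊥-elim (n+1+n-not-even n (∣m+n∣m⇒∣n even-sum even-m))
  where
  even-sum : Even (m + (n + suc n))
  even-sum = subst Even
    (trans (cong (_+ suc n) (IncidenceTree.∑-degree H tree)) (+-assoc m n (suc n)))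
    (∑-odd (degree H) (λ v even → no-even-vertex (v , even)))
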